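{- For every finite set $X$ let $\mathbf{G}[X]$ be the vector space (over a field $\mathbb{K}$ of characteristic $0$) with basis the set $\mathscr{G}[X]$ of mixed graphs with vertex set $X$. For finite disjoint sets $X,Y$ define $m_{X,Y}:\mathbf{G}[X]\otimes\mathbf{G}[Y]\to\mathbf{G}[X\sqcup Y]$ by $m_{X,Y}(G\otimes H)=GH$ (disjoint union: $V(GH)=V(G)\sqcup V(H)$, $E(GH)=E(G)\sqcup E(H)$, $A(GH)=A(G)\sqcup A(H)$), and $\Delta_{X,Y}:\mathbf{G}[X\sqcup Y]\to\mathbf{G}[X]\otimes\mathbf{G}[Y]$ by $\Delta_{X,Y}(G)=G_{\mid X}\otimes G_{\mid Y}$ if $Y$ is an ideal of $G$, and $\Delta_{X,Y}(G)=0$ otherwise. Then $\mathbf{G}$ with these maps is a twisted bialgebra (a bialgebra in the category of species with the Cauchy tensor product). Explicitly: the product is associative, commutative, with unit the empty graph $1\in\mathscr{G}[\emptyset]$; for pairwise disjoint finite sets $X,Y,Z$, $(\Delta_{X,Y}\otimes\mathrm{Id})\circ\Delta_{X\sqcup Y,Z}=(\mathrm{Id}\otimes\Delta_{Y,Z})\circ\Delta_{X,Y\sqcup Z}$ on $\mathbf{G}[X\sqcup Y\sqcup Z]$; for every mixed graph $G$, $\Delta_{V(G),\emptyset}(G)=G\otimes 1$ and $\Delta_{\emptyset,V(G)}(G)=1\otimes G$; and for $G\in\mathscr{G}[X]$, $H\in\mathscr{G}[Y]$ and any decomposition $X\sqcup Y=X'\sqcup Y'$, $\Delta_{X',Y'}(GH)=\Delta_{X\cap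 X',X\cap Y'}(G)\,\Delta_{Y\cap X',Y\cap Y'}(H)$ (product taken componentwise via the maps $m$), and $\Delta_{\emptyset,\emptyset}(1)=1\otimes 1$.
   Context: A mixed graph $G=(V(G),E(G),A(G))$ consists of a finite set $V(G)$ of vertices, a set $E(G)$ of edges (2-element subsets $\{x,y\}$ of $V(G)$) and a set $A(G)$ of arcs (ordered pairs $(x,y)$ with $x\neq y$ in $V(G)$), such that if $\{x,y\}\in E(G)$ then neither $(x,y)$ nor $(y,x)$ is in $A(G)$ (both $(x,y)$ and $(y,x)$ may be arcs simultaneously). For $I\subseteq V(G)$, $G_{\mid I}$ is the mixed graph with vertex set $I$ and the edges and arcs of $G$ with both extremities in $I$. A subset $I\subseteq V(G)$ is an ideal of $G$ if for all $x,y\in V(G)$, $x\in I$ and $(x,y)\in A(G)$ imply $y\in I$. -}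

module Defs where

-- Mixed graphs whose vertices lie in an ambient finite set  Fin n.
-- A finite vertex set X is a subset of Fin n (Data.Fin.Subset).  All structure maps send basis elements to either a basis
-- tensor or 0, so we describe them on basis elements.

open import Data.Nat.Base using (ℕ)
open import Data.Bool.Base using (Bool; true; false; _∧_; _∨_; if_then_else_)
open import Data.Bool.Properties using () renaming (_≟_ to _≟ᵇ_)
open import Data.Fin.Base using (Fin)
open import Data.Fin.Subset using (Subset; _∈_; _∩_; _∪_; ⊥)
open import Data.Fin.Subset.Properties using (_∈?_)
open import Data.Fin.Properties using (all?)
open import Data.Vec.Base using (Vec; lookup; tabulate; zipWith; replicate)
open import Data.Product.Base using (_×_; _,_)
open import Data.Maybe.Base using (Maybe; just; nothing)
open import Relation.Binary.PropositionalEquality using (_≡_; _≢_)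
open import Relation.Nullary.Decidable using (Dec; does; _→-dec_)

Matrix : ℕ → Set
Matrix n = Vec (Vec Bool n) n

entry : ∀ {n} → Matrix n → Fin n → Fin n → Bool
entry M x y = lookup (lookup M x) y

-- Raw data of a (potential) mixed graph: vertex set V, edges E (symmetric
-- matrix: E x y = true means {x,y} is an edge), arcs A (A x y = true means
-- (x,y) is an arc).
record MGraph (n : ℕ) : Set where
  constructor mgraph
  field
    V : Subset n
    E : Matrix n
    A : Matrix n
open MGraph public

record IsMixedGraph {n : ℕ} (G : MGraph n) : Set where
  field
    edge-ends : ∀ x y → entry (E G) x y ≡ true → x ∈ V G × y ∈ V G
    edge-irrefl : ∀ x y → entry (E G) x y ≡ true → x ≢ y
    edge-sym : ∀ x y → entry (E G) x y ≡ true → entry (E G) y x ≡ true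
    edge-no-arc : ∀ x y → entry (E G) x y ≡ true → entry (A G) x y ≡ false
    arc-ends : ∀ x y → entry (A G) x y ≡ true → x ∈ V G × y ∈ V G
    arc-irrefl : ∀ x y → entry (A G) x y ≡ true → x ≢ y

Disjoint : ∀ {n} → Subset n → Subset n → Set
Disjoint X Y = X ∩ Y ≡ ⊥

one : ∀ {n} → MGraph n
one {n} = mgraph ⊥ (replicate n (replicate n false)) (replicate n (replicate n false))

_·_ : ∀ {n} → MGraph n → MGraph n → MGraph n
G · H = mgraph (V G ∪ V H) (zipWith (zipWith _∨_) (E G) (E H)) (zipWith (zipWith _∨_) (A G) (A H))

restrictM : ∀ {n} → Subset n → Matrix n → Matrix n
restrictM I M = tabulate λ x → tabulate λ y → entry M x y ∧ lookup I x ∧ lookup I y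

_∣_ : ∀ {n} → MGraph n → Subset n → MGraph n
G ∣ I = mgraph (V G ∩ I) (restrictM I (E G)) (restrictM I (A G))

IsIdeal : ∀ {n} → MGraph n → Subset n → Set
IsIdeal G I = ∀ x y → x ∈ I → entry (A G) x y ≡ true → y ∈ I

isIdeal? : ∀ {n} (G : MGraph n) (I : Subset n) → Dec (IsIdeal G I)
isIdeal? G I = all? λ x → all? λ y → (x ∈? I) →-dec ((entry (A G) x y ≟ᵇ true) →-dec (y ∈? I))

-- Coproduct Δ_{X,Y} on a basis element: just (G_{|X} , G_{|Y}) stands for the
-- basis tensor G_{|X} ⊗ G_{|Y}, and nothing stands for 0.
Δ : ∀ {n} → Subset n → Subset n → MGraph n → Maybe (MGraph n × MGraph n)
Δ X Y G = if does (isIdeal? G Y) then just (G ∣ X , G ∣ Y) else nothing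

-- (Δ_{X,Y} ⊗ Id) applied to  0  or a basis tensor  a ⊗ b ; result in triple
-- tensors, written  a₁ , (a₂ , b)  (associator identified).
Δ⊗Id : ∀ {n} → Subset n → Subset n → Maybe (MGraph n × MGraph n) → Maybe (MGraph n × MGraph n × MGraph n)
Δ⊗Id X Y nothing = nothing
Δ⊗Id X Y (just (a , b)) with Δ X Y a
... | nothing = nothing
... | just (a₁ , a₂) = just (a₁ , a₂ , b)

Id⊗Δ : ∀ {n} → Subset n → Subset n → Maybe (MGraph n × MGraph n) → Maybe (MGraph n × MGraph n × MGraph n)
Id⊗Δ Y Z nothing = nothing
Id⊗Δ Y Z (just (a , b)) with Δ Y Z b
... | nothing = nothing
... | just (b₁ , b₂) = just (a , b₁ , b₂)

_⊙_ : ∀ {n} → Maybe (MGraph n × MGraph n) → Maybe (MGraph n × MGraph n) → Maybe (MGraph n × MGraph n)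
just (a , b) ⊙ just (c , d) = just (a · c , b · d)
just _ ⊙ nothing = nothing
nothing ⊙ _ = nothing

module Submission where

-- All structure maps act on a basis graph by overlaying or restricting its adjacency matrices,
-- so the algebra axioms are the lattice laws of ∨ entrywise.  Restriction commutes with overlay
-- and (G ∣ I) ∣ J = G ∣ (I ∩ J), which reduces the coalgebra axioms to facts about ideals: the
-- ideals of G · H are the common ideals of G and H, and when V(G) = X ⊔ Y ⊔ Z both
-- "Z is an ideal of G and Y one of G ∣ (X ∪ Y)" and "Y ∪ Z is an ideal of G and Z one of
-- G ∣ (Y ∪ Z)" say that no arc leaves Z or enters X from Y.

open import Defs
open import Data.Nat.Base using (ℕ)
open import Data.Bool.Base using (Bool; true; false; _∧_; _∨_)
open import Data.Bool.Properties
  using (∨-assoc; ∨-comm; ∨-identityˡ; ∨-identityʳ; ∨-zeroʳ; ∧-assoc; ∧-zeroʳ; ∧-distribʳ-∨; ∧-commutativeMonoid)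
open import Data.Fin.Base using (Fin)
open import Data.Fin.Subset using (Subset; _∩_; _∪_; ⊥; _∈_; _∉_; _⊆_)
open import Data.Fin.Subset.Properties
  using (∪-assoc; ∪-comm; ∪-identityˡ; ∪-identityʳ; ∩-assoc; ∩-comm; ∩-idem; ∩-zeroʳ; ∩-abs-∪;
         ∩-distribʳ-∪; ∉⊥; x∈p∩q⁺; x∈p∩q⁻; x∈p∪q⁺; x∈p∪q⁻; q⊆p∪q; ⊆-reflexive)
open import Data.Vec.Base using (Vec; lookup; tabulate; zipWith; replicate)
open import Data.Vec.Properties
  using (lookup-zipWith; lookup-replicate; lookup∘tabulate; tabulate∘lookup; tabulate-cong;
         zipWith-assoc; zipWith-comm; zipWith-identityˡ; zipWith-identityʳ; []=⇒lookup; lookup⇒[]=)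
open import Data.Product.Base using (_×_; _,_; proj₁; proj₂)
open import Data.Sum.Base using (_⊎_; inj₁; inj₂)
open import Data.Maybe.Base using (just; nothing)
open import Function.Base using (_∘_)
open import Function.Bundles using (_⇔_; mk⇔; Equivalence)
open import Algebra.Bundles using (CommutativeMonoid)
open import Algebra.Properties.CommutativeSemigroup
  (CommutativeMonoid.commutativeSemigroup ∧-commutativeMonoid) using (interchange)
open import Relation.Binary.PropositionalEquality
  using (_≡_; refl; sym; trans; cong; cong₂; subst; module ≡-Reasoning)
open import Relation.Nullary using (¬_; yes; no; contradiction)
open import Relation.Nullary.Decidable using (dec-true; dec-false; _×-dec_)

private variable
  n : ℕ
  x y : Fin n
  a b : Bool
  I J S X Y Z X′ Y′ : Subset n
  M N : Matrix n
  G H : MGraph n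

∧-true⁻ : a ∧ b ≡ true → a ≡ true × b ≡ true
∧-true⁻ {true} p = refl , p

∨-true⁻ : ∀ a → a ∨ b ≡ true → a ≡ true ⊎ b ≡ true
∨-true⁻ true  _ = inj₁ refl
∨-true⁻ false p = inj₂ p

∨-trueˡ : ∀ b → a ≡ true → a ∨ b ≡ true
∨-trueˡ b refl = refl

∨-trueʳ : ∀ a → b ≡ true → a ∨ b ≡ true
∨-trueʳ a refl = ∨-zeroʳ a

∧-implied : ∀ a → (a ≡ true → b ≡ true) → a ∧ b ≡ a
∧-implied false _ = refl
∧-implied true  f = f refl

_∨ᴹ_ : Matrix n → Matrix n → Matrix n
_∨ᴹ_ = zipWith (zipWith _∨_)

0ᴹ : Matrix n
0ᴹ {n} = replicate n (replicate n false)

Vec-ext : {A : Set} {u v : Vec A n} → (∀ i → lookup u i ≡ lookup v i) → u ≡ v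
Vec-ext {u = u} {v} p = trans (sym (tabulate∘lookup u)) (trans (tabulate-cong p) (tabulate∘lookup v))

Matrix-ext : (∀ x y → entry M x y ≡ entry N x y) → M ≡ N
Matrix-ext p = Vec-ext λ x → Vec-ext (p x)

entry-∨ᴹ : ∀ (M N : Matrix n) x y → entry (M ∨ᴹ N) x y ≡ entry M x y ∨ entry N x y
entry-∨ᴹ M N x y rewrite lookup-zipWith (zipWith _∨_) x M N = lookup-zipWith _∨_ y (lookup M x) (lookup N x)

entry-0ᴹ : ∀ (x y : Fin n) → entry 0ᴹ x y ≡ false
entry-0ᴹ {n} x y rewrite lookup-replicate x (replicate n false) = lookup-replicate y false

entry-restrictM : ∀ I (M : Matrix n) x y → entry (restrictM I M) x y ≡ entry M x y ∧ lookup I x ∧ lookup I y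
entry-restrictM I M x y
  rewrite lookup∘tabulate (λ x → tabulate λ y → entry M x y ∧ lookup I x ∧ lookup I y) x =
  lookup∘tabulate (λ y → entry M x y ∧ lookup I x ∧ lookup I y) y

lookup-∩ : ∀ (I J : Subset n) x → lookup (I ∩ J) x ≡ lookup I x ∧ lookup J x
lookup-∩ I J x = lookup-zipWith _∧_ x I J

restrictM-∨ᴹ : ∀ I (M N : Matrix n) → restrictM I (M ∨ᴹ N) ≡ restrictM I M ∨ᴹ restrictM I N
restrictM-∨ᴹ I M N = Matrix-ext λ x y → begin
  entry (restrictM I (M ∨ᴹ N)) x y
    ≡⟨ entry-restrictM I (M ∨ᴹ N) x y ⟩
  entry (M ∨ᴹ N) x y ∧ lookup I x ∧ lookup I y
    ≡⟨ cong (_∧ _) (entry-∨ᴹ M N x y) ⟩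
  (entry M x y ∨ entry N x y) ∧ lookup I x ∧ lookup I y
    ≡⟨ ∧-distribʳ-∨ _ (entry M x y) (entry N x y) ⟩
  (entry M x y ∧ lookup I x ∧ lookup I y) ∨ (entry N x y ∧ lookup I x ∧ lookup I y)
    ≡⟨ sym (cong₂ _∨_ (entry-restrictM I M x y) (entry-restrictM I N x y)) ⟩
  entry (restrictM I M) x y ∨ entry (restrictM I N) x y
    ≡⟨ sym (entry-∨ᴹ (restrictM I M) (restrictM I N) x y) ⟩
  entry (restrictM I M ∨ᴹ restrictM I N) x y ∎
  where open ≡-Reasoning

restrictM-restrictM : ∀ I J (M : Matrix n) → restrictM J (restrictM I M) ≡ restrictM (I ∩ J) M
restrictM-restrictM I J M = Matrix-ext λ x y → begin
  entry (restrictM J (restrictM I M)) x y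
    ≡⟨ entry-restrictM J (restrictM I M) x y ⟩
  entry (restrictM I M) x y ∧ lookup J x ∧ lookup J y
    ≡⟨ cong (_∧ _) (entry-restrictM I M x y) ⟩
  (entry M x y ∧ lookup I x ∧ lookup I y) ∧ lookup J x ∧ lookup J y
    ≡⟨ ∧-assoc (entry M x y) _ _ ⟩
  entry M x y ∧ (lookup I x ∧ lookup I y) ∧ (lookup J x ∧ lookup J y)
    ≡⟨ cong (entry M x y ∧_) (interchange (lookup I x) (lookup I y) (lookup J x) (lookup J y)) ⟩
  entry M x y ∧ (lookup I x ∧ lookup J x) ∧ (lookup I y ∧ lookup J y)
    ≡⟨ sym (cong (λ b → entry M x y ∧ b) (cong₂ _∧_ (lookup-∩ I J x) (lookup-∩ I J y))) ⟩
  entry M x y ∧ lookup (I ∩ J) x ∧ lookup (I ∩ J) y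
    ≡⟨ sym (entry-restrictM (I ∩ J) M x y) ⟩
  entry (restrictM (I ∩ J) M) x y ∎
  where open ≡-Reasoning

restrictM-⊥ : ∀ (M : Matrix n) → restrictM ⊥ M ≡ 0ᴹ
restrictM-⊥ {n} M = Matrix-ext λ x y → begin
  entry (restrictM ⊥ M) x y                     ≡⟨ entry-restrictM ⊥ M x y ⟩
  entry M x y ∧ lookup ⊥ x ∧ lookup (⊥ {n}) y   ≡⟨ cong (λ b → entry M x y ∧ b ∧ _) (lookup-replicate x false) ⟩
  entry M x y ∧ false                            ≡⟨ ∧-zeroʳ (entry M x y) ⟩
  false                                          ≡⟨ sym (entry-0ᴹ x y) ⟩
  entry 0ᴹ x y                                    ∎
  where open ≡-Reasoning

restrictM-supported : (∀ x y → entry M x y ≡ true → x ∈ I × y ∈ I) → restrictM I M ≡ M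
restrictM-supported {M = M} {I} sup = Matrix-ext λ x y →
  trans (entry-restrictM I M x y) (∧-implied (entry M x y) λ m → let x∈I , y∈I = sup x y m in
    cong₂ _∧_ ([]=⇒lookup x∈I) ([]=⇒lookup y∈I))

mgraph-cong : ∀ {V₁ V₂ : Subset n} {E₁ E₂ A₁ A₂ : Matrix n} →
  V₁ ≡ V₂ → E₁ ≡ E₂ → A₁ ≡ A₂ → mgraph V₁ E₁ A₁ ≡ mgraph V₂ E₂ A₂
mgraph-cong refl refl refl = refl

·-assoc : ∀ (G H K : MGraph n) → (G · H) · K ≡ G · (H · K)
·-assoc G H K = mgraph-cong (∪-assoc (V G) (V H) (V K)) (∨ᴹ-assoc (E G) (E H) (E K)) (∨ᴹ-assoc (A G) (A H) (A K))
  where ∨ᴹ-assoc = zipWith-assoc (zipWith-assoc ∨-assoc)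

·-comm : ∀ (G H : MGraph n) → G · H ≡ H · G
·-comm G H = mgraph-cong (∪-comm (V G) (V H)) (∨ᴹ-comm (E G) (E H)) (∨ᴹ-comm (A G) (A H))
  where ∨ᴹ-comm = zipWith-comm (zipWith-comm ∨-comm)

·-identityˡ : ∀ (G : MGraph n) → one · G ≡ G
·-identityˡ G = mgraph-cong (∪-identityˡ (V G)) (∨ᴹ-identityˡ (E G)) (∨ᴹ-identityˡ (A G))
  where ∨ᴹ-identityˡ = zipWith-identityˡ (zipWith-identityˡ ∨-identityˡ)

·-identityʳ : ∀ (G : MGraph n) → G · one ≡ G
·-identityʳ G = mgraph-cong (∪-identityʳ (V G)) (∨ᴹ-identityʳ (E G)) (∨ᴹ-identityʳ (A G))
  where ∨ᴹ-identityʳ = zipWith-identityʳ (zipWith-identityʳ ∨-identityʳ)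

∣-· : ∀ (G H : MGraph n) I → (G · H) ∣ I ≡ (G ∣ I) · (H ∣ I)
∣-· G H I = mgraph-cong (∩-distribʳ-∪ I (V G) (V H)) (restrictM-∨ᴹ I (E G) (E H)) (restrictM-∨ᴹ I (A G) (A H))

∣-∣ : ∀ (G : MGraph n) I J → (G ∣ I) ∣ J ≡ G ∣ (I ∩ J)
∣-∣ G I J = mgraph-cong (∩-assoc (V G) I J) (restrictM-restrictM I J (E G)) (restrictM-restrictM I J (A G))

∣-⊥ : ∀ (G : MGraph n) → G ∣ ⊥ ≡ one
∣-⊥ G = mgraph-cong (∩-zeroʳ (V G)) (restrictM-⊥ (E G)) (restrictM-⊥ (A G))

∣-V : IsMixedGraph G → G ∣ V G ≡ G
∣-V {G = G} G-mixed = mgraph-cong (∩-idem (V G))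
  (restrictM-supported (IsMixedGraph.edge-ends G-mixed)) (restrictM-supported (IsMixedGraph.arc-ends G-mixed))

∣-V∩ : IsMixedGraph G → ∀ I → G ∣ (V G ∩ I) ≡ G ∣ I
∣-V∩ {G = G} G-mixed I = trans (sym (∣-∣ G (V G) I)) (cong (_∣ I) (∣-V G-mixed))

∣-∪-∣ˡ : ∀ (G : MGraph n) I J → (G ∣ (I ∪ J)) ∣ I ≡ G ∣ I
∣-∪-∣ˡ G I J = trans (∣-∣ G (I ∪ J) I) (cong (G ∣_) (trans (∩-comm (I ∪ J) I) (∩-abs-∪ I J)))

∣-∪-∣ʳ : ∀ (G : MGraph n) I J → (G ∣ (I ∪ J)) ∣ J ≡ G ∣ J
∣-∪-∣ʳ G I J = trans (cong (λ K → (G ∣ K) ∣ J) (∪-comm I J)) (∣-∪-∣ˡ G J I)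

Arc : MGraph n → Fin n → Fin n → Set
Arc G x y = entry (A G) x y ≡ true

arc-·⁻ : Arc (G · H) x y → Arc G x y ⊎ Arc H x y
arc-·⁻ {G = G} {H} {x} {y} arc = ∨-true⁻ (entry (A G) x y) (trans (sym (entry-∨ᴹ (A G) (A H) x y)) arc)

arc-·⁺ˡ : Arc G x y → Arc (G · H) x y
arc-·⁺ˡ {G = G} {x} {y} {H} arc = trans (entry-∨ᴹ (A G) (A H) x y) (∨-trueˡ (entry (A H) x y) arc)

arc-·⁺ʳ : Arc H x y → Arc (G · H) x y
arc-·⁺ʳ {H = H} {x} {y} {G} arc = trans (entry-∨ᴹ (A G) (A H) x y) (∨-trueʳ (entry (A G) x y) arc)

arc-∣⁻ : Arc (G ∣ I) x y → Arc G x y × x ∈ I × y ∈ I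
arc-∣⁻ {G = G} {I} {x} {y} arc =
  let arcᴳ , ends = ∧-true⁻ (trans (sym (entry-restrictM I (A G) x y)) arc)
      Ix , Iy = ∧-true⁻ ends
  in arcᴳ , lookup⇒[]= x I Ix , lookup⇒[]= y I Iy

arc-∣⁺ : Arc G x y → x ∈ I → y ∈ I → Arc (G ∣ I) x y
arc-∣⁺ {G = G} {x} {y} {I} arc x∈I y∈I = begin
  entry (restrictM I (A G)) x y              ≡⟨ entry-restrictM I (A G) x y ⟩
  entry (A G) x y ∧ lookup I x ∧ lookup I y  ≡⟨ cong₂ (λ a b → a ∧ b ∧ lookup I y) arc ([]=⇒lookup x∈I) ⟩
  lookup I y                                 ≡⟨ []=⇒lookup y∈I ⟩
  true                                       ∎
  where open ≡-Reasoning

⊥-isIdeal : ∀ (G : MGraph n) → IsIdeal G ⊥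
⊥-isIdeal G x y x∈⊥ _ = contradiction x∈⊥ ∉⊥

V-isIdeal : IsMixedGraph G → IsIdeal G (V G)
V-isIdeal G-mixed x y _ arc = proj₂ (IsMixedGraph.arc-ends G-mixed x y arc)

isIdeal-· : IsIdeal G I → IsIdeal H I → IsIdeal (G · H) I
isIdeal-· {G = G} {H = H} I-ideal-G I-ideal-H x y x∈I arc with arc-·⁻ {G = G} {H} {x} {y} arc
... | inj₁ arcᴳ = I-ideal-G x y x∈I arcᴳ
... | inj₂ arcᴴ = I-ideal-H x y x∈I arcᴴ

isIdeal-·⁻ˡ : IsIdeal (G · H) I → IsIdeal G I
isIdeal-·⁻ˡ {G = G} {H = H} I-ideal x y x∈I arc = I-ideal x y x∈I (arc-·⁺ˡ {G = G} {x} {y} {H} arc)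

isIdeal-·⁻ʳ : IsIdeal (G · H) I → IsIdeal H I
isIdeal-·⁻ʳ {G = G} {H = H} I-ideal x y x∈I arc = I-ideal x y x∈I (arc-·⁺ʳ {H = H} {x} {y} {G} arc)

isIdeal-∣ : IsIdeal G I → IsIdeal (G ∣ S) I
isIdeal-∣ {G = G} {S = S} I-ideal x y x∈I arc = I-ideal x y x∈I (proj₁ (arc-∣⁻ {G = G} {S} {x} {y} arc))

isIdeal-V∩ : IsMixedGraph G → IsIdeal G (V G ∩ I) ⇔ IsIdeal G I
isIdeal-V∩ {G = G} {I} G-mixed = mk⇔
  (λ ideal x y x∈I arc → let x∈V , _ = ends x y arc in
    proj₂ (x∈p∩q⁻ (V G) I (ideal x y (x∈p∩q⁺ (x∈V , x∈I)) arc)))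
  (λ ideal x y x∈V∩I arc → x∈p∩q⁺ (proj₂ (ends x y arc) , ideal x y (proj₂ (x∈p∩q⁻ (V G) I x∈V∩I)) arc))
  where ends = IsMixedGraph.arc-ends G-mixed

∉-Disjoint : Disjoint X Z → x ∈ X → x ∉ Z
∉-Disjoint {x = x} X∩Z≡⊥ x∈X x∈Z = ∉⊥ (subst (x ∈_) X∩Z≡⊥ (x∈p∩q⁺ (x∈X , x∈Z)))

isIdeal-of-∣ : IsIdeal G I → IsIdeal (G ∣ I) J → J ⊆ I → IsIdeal G J
isIdeal-of-∣ {G = G} {I} I-ideal J-ideal J⊆I x y x∈J arc =
  J-ideal x y x∈J (arc-∣⁺ {G = G} {x} {y} {I} arc (J⊆I x∈J) (I-ideal x y (J⊆I x∈J) arc))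

isIdeal-∪-of-∣ : IsMixedGraph G → V G ⊆ S ∪ Z → Y ⊆ S →
  IsIdeal G Z → IsIdeal (G ∣ S) Y → IsIdeal G (Y ∪ Z)
isIdeal-∪-of-∣ {G = G} {S} {Z} {Y} G-mixed V⊆S∪Z Y⊆S Z-ideal Y-ideal x y x∈Y∪Z arc
  with x∈p∪q⁻ Y Z x∈Y∪Z
... | inj₂ x∈Z = x∈p∪q⁺ (inj₂ (Z-ideal x y x∈Z arc))
... | inj₁ x∈Y with x∈p∪q⁻ S Z (V⊆S∪Z (proj₂ (IsMixedGraph.arc-ends G-mixed x y arc)))
...   | inj₁ y∈S = x∈p∪q⁺ (inj₁ (Y-ideal x y x∈Y (arc-∣⁺ {G = G} {x} {y} {S} arc (Y⊆S x∈Y) y∈S)))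
...   | inj₂ y∈Z = x∈p∪q⁺ (inj₂ y∈Z)

isIdeal-∣-∪ : Disjoint X Z → IsIdeal G (Y ∪ Z) → IsIdeal (G ∣ (X ∪ Y)) Y
isIdeal-∣-∪ {X = X} {Z} {G} {Y} X∩Z≡⊥ YZ-ideal x y x∈Y arc
  with arc-∣⁻ {G = G} {X ∪ Y} {x} {y} arc
... | arcᴳ , _ , y∈X∪Y with x∈p∪q⁻ X Y y∈X∪Y | x∈p∪q⁻ Y Z (YZ-ideal x y (x∈p∪q⁺ (inj₁ x∈Y)) arcᴳ)
...   | inj₂ y∈Y | _        = y∈Y
...   | inj₁ _   | inj₁ y∈Y = y∈Y
...   | inj₁ y∈X | inj₂ y∈Z = contradiction y∈Z (∉-Disjoint X∩Z≡⊥ y∈X)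

coassoc-ideals : IsMixedGraph G → V G ≡ (X ∪ Y) ∪ Z → Disjoint X Z →
  (IsIdeal G Z × IsIdeal (G ∣ (X ∪ Y)) Y) ⇔ (IsIdeal G (Y ∪ Z) × IsIdeal (G ∣ (Y ∪ Z)) Z)
coassoc-ideals {G = G} {X} {Y} {Z} G-mixed V≡X∪Y∪Z X∩Z≡⊥ = mk⇔
  (λ (Z-ideal , Y-ideal) →
    isIdeal-∪-of-∣ G-mixed (⊆-reflexive V≡X∪Y∪Z) (q⊆p∪q X Y) Z-ideal Y-ideal , isIdeal-∣ {G = G} {S = Y ∪ Z} Z-ideal)
  (λ (YZ-ideal , Z-ideal) → isIdeal-of-∣ {G = G} YZ-ideal Z-ideal (q⊆p∪q Y Z) , isIdeal-∣-∪ {G = G} X∩Z≡⊥ YZ-ideal)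

Δ-ideal : ∀ X (G : MGraph n) → IsIdeal G Y → Δ X Y G ≡ just (G ∣ X , G ∣ Y)
Δ-ideal {Y = Y} X G Y-ideal rewrite dec-true (isIdeal? G Y) Y-ideal = refl

Δ-nonideal : ∀ X (G : MGraph n) → ¬ IsIdeal G Y → Δ X Y G ≡ nothing
Δ-nonideal {Y = Y} X G Y-nonideal rewrite dec-false (isIdeal? G Y) Y-nonideal = refl

Δ-cong : ∀ (G : MGraph n) → (IsIdeal G Y ⇔ IsIdeal G Y′) → G ∣ X ≡ G ∣ X′ → G ∣ Y ≡ G ∣ Y′ →
  Δ X Y G ≡ Δ X′ Y′ G
Δ-cong {Y = Y} {Y′} {X} {X′} G Y⇔Y′ G∣X≡G∣X′ G∣Y≡G∣Y′ with isIdeal? G Y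
... | yes Y-ideal = begin
  Δ X Y G                  ≡⟨ Δ-ideal X G Y-ideal ⟩
  just (G ∣ X , G ∣ Y)     ≡⟨ cong₂ (λ a b → just (a , b)) G∣X≡G∣X′ G∣Y≡G∣Y′ ⟩
  just (G ∣ X′ , G ∣ Y′)   ≡⟨ Δ-ideal X′ G (Equivalence.to Y⇔Y′ Y-ideal) ⟨
  Δ X′ Y′ G                ∎
  where open ≡-Reasoning
... | no Y-nonideal =
  trans (Δ-nonideal X G Y-nonideal) (sym (Δ-nonideal X′ G (Y-nonideal ∘ Equivalence.from Y⇔Y′)))

Δ-V∩ : IsMixedGraph G → ∀ X Y → Δ (V G ∩ X) (V G ∩ Y) G ≡ Δ X Y G
Δ-V∩ {G = G} G-mixed X Y = Δ-cong G (isIdeal-V∩ G-mixed) (∣-V∩ G-mixed X) (∣-V∩ G-mixed Y)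

Δ-· : ∀ X Y (G H : MGraph n) → Δ X Y (G · H) ≡ Δ X Y G ⊙ Δ X Y H
Δ-· X Y G H with isIdeal? G Y | isIdeal? H Y
... | yes Y-ideal-G | yes Y-ideal-H
  rewrite Δ-ideal X (G · H) (isIdeal-· {G = G} {H = H} Y-ideal-G Y-ideal-H)
        | Δ-ideal X G Y-ideal-G | Δ-ideal X H Y-ideal-H
  = cong₂ (λ a b → just (a , b)) (∣-· G H X) (∣-· G H Y)
... | yes Y-ideal-G | no Y-nonideal-H
  rewrite Δ-nonideal X (G · H) (Y-nonideal-H ∘ isIdeal-·⁻ʳ {G = G} {H = H})
        | Δ-ideal X G Y-ideal-G | Δ-nonideal X H Y-nonideal-H
  = refl
... | no Y-nonideal-G | _
  rewrite Δ-nonideal X (G · H) (Y-nonideal-G ∘ isIdeal-·⁻ˡ {G = G} {H = H}) | Δ-nonideal X G Y-nonideal-G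
  = refl

Δ⊗Id-Δ : ∀ X Y S Z (G : MGraph n) → IsIdeal G Z × IsIdeal (G ∣ S) Y →
  Δ⊗Id X Y (Δ S Z G) ≡ just ((G ∣ S) ∣ X , (G ∣ S) ∣ Y , G ∣ Z)
Δ⊗Id-Δ X Y S Z G (Z-ideal , Y-ideal) rewrite Δ-ideal S G Z-ideal | Δ-ideal X (G ∣ S) Y-ideal = refl

Δ⊗Id-Δ-nonideal : ∀ X Y S Z (G : MGraph n) → ¬ (IsIdeal G Z × IsIdeal (G ∣ S) Y) →
  Δ⊗Id X Y (Δ S Z G) ≡ nothing
Δ⊗Id-Δ-nonideal X Y S Z G nonideal with isIdeal? G Z
... | no Z-nonideal rewrite Δ-nonideal S G Z-nonideal = refl
... | yes Z-ideal rewrite Δ-ideal S G Z-ideal | Δ-nonideal X (G ∣ S) (λ Y-ideal → nonideal (Z-ideal , Y-ideal)) = refl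

Id⊗Δ-Δ : ∀ X S Y Z (G : MGraph n) → IsIdeal G S × IsIdeal (G ∣ S) Z →
  Id⊗Δ Y Z (Δ X S G) ≡ just (G ∣ X , (G ∣ S) ∣ Y , (G ∣ S) ∣ Z)
Id⊗Δ-Δ X S Y Z G (S-ideal , Z-ideal) rewrite Δ-ideal X G S-ideal | Δ-ideal Y (G ∣ S) Z-ideal = refl

Id⊗Δ-Δ-nonideal : ∀ X S Y Z (G : MGraph n) → ¬ (IsIdeal G S × IsIdeal (G ∣ S) Z) →
  Id⊗Δ Y Z (Δ X S G) ≡ nothing
Id⊗Δ-Δ-nonideal X S Y Z G nonideal with isIdeal? G S
... | no S-nonideal rewrite Δ-nonideal X G S-nonideal = refl
... | yes S-ideal rewrite Δ-ideal X G S-ideal | Δ-nonideal Y (G ∣ S) (λ Z-ideal → nonideal (S-ideal , Z-ideal)) = refl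

Δ-coassoc : IsMixedGraph G → V G ≡ (X ∪ Y) ∪ Z → Disjoint X Z →
  Δ⊗Id X Y (Δ (X ∪ Y) Z G) ≡ Id⊗Δ Y Z (Δ X (Y ∪ Z) G)
Δ-coassoc {G = G} {X} {Y} {Z} G-mixed V≡X∪Y∪Z X∩Z≡⊥
  with isIdeal? G Z ×-dec isIdeal? (G ∣ (X ∪ Y)) Y
... | yes ideals = begin
  Δ⊗Id X Y (Δ (X ∪ Y) Z G)
    ≡⟨ Δ⊗Id-Δ X Y (X ∪ Y) Z G ideals ⟩
  just ((G ∣ (X ∪ Y)) ∣ X , (G ∣ (X ∪ Y)) ∣ Y , G ∣ Z)
    ≡⟨ cong₂ (λ a b → just (a , b , G ∣ Z)) (∣-∪-∣ˡ G X Y) (∣-∪-∣ʳ G X Y) ⟩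
  just (G ∣ X , G ∣ Y , G ∣ Z)
    ≡⟨ cong₂ (λ b c → just (G ∣ X , b , c)) (∣-∪-∣ˡ G Y Z) (∣-∪-∣ʳ G Y Z) ⟨
  just (G ∣ X , (G ∣ (Y ∪ Z)) ∣ Y , (G ∣ (Y ∪ Z)) ∣ Z)
    ≡⟨ Id⊗Δ-Δ X (Y ∪ Z) Y Z G (Equivalence.to (coassoc-ideals G-mixed V≡X∪Y∪Z X∩Z≡⊥) ideals) ⟨
  Id⊗Δ Y Z (Δ X (Y ∪ Z) G) ∎
  where open ≡-Reasoning
... | no nonideal = trans (Δ⊗Id-Δ-nonideal X Y (X ∪ Y) Z G nonideal)
  (sym (Id⊗Δ-Δ-nonideal X (Y ∪ Z) Y Z G (nonideal ∘ Equivalence.from (coassoc-ideals G-mixed V≡X∪Y∪Z X∩Z≡⊥))))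

Δ-counitʳ : IsMixedGraph G → Δ (V G) ⊥ G ≡ just (G , one)
Δ-counitʳ {G = G} G-mixed =
  trans (Δ-ideal (V G) G (⊥-isIdeal G)) (cong₂ (λ a b → just (a , b)) (∣-V G-mixed) (∣-⊥ G))

Δ-counitˡ : IsMixedGraph G → Δ ⊥ (V G) G ≡ just (one , G)
Δ-counitˡ {G = G} G-mixed =
  trans (Δ-ideal ⊥ G (V-isIdeal G-mixed)) (cong₂ (λ a b → just (a , b)) (∣-⊥ G) (∣-V G-mixed))

Δ-one : Δ ⊥ ⊥ (one {n}) ≡ just (one , one)
Δ-one = trans (Δ-ideal ⊥ one (⊥-isIdeal one)) (cong₂ (λ a b → just (a , b)) (∣-⊥ one) (∣-⊥ one))

Δ-compatible : IsMixedGraph G → IsMixedGraph H → V G ≡ X → V H ≡ Y →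
  Δ X′ Y′ (G · H) ≡ Δ (X ∩ X′) (X ∩ Y′) G ⊙ Δ (Y ∩ X′) (Y ∩ Y′) H
Δ-compatible {G = G} {H} {X′ = X′} {Y′} G-mixed H-mixed refl refl = begin
  Δ X′ Y′ (G · H)                                               ≡⟨ Δ-· X′ Y′ G H ⟩
  Δ X′ Y′ G ⊙ Δ X′ Y′ H                                         ≡⟨ cong₂ _⊙_ (Δ-V∩ G-mixed X′ Y′) (Δ-V∩ H-mixed X′ Y′) ⟨
  Δ (V G ∩ X′) (V G ∩ Y′) G ⊙ Δ (V H ∩ X′) (V H ∩ Y′) H         ∎
  where open ≡-Reasoning

proposition1p4 : (n : ℕ) →
    -- product associative
    ((G H K : MGraph n) → IsMixedGraph G → IsMixedGraph H → IsMixedGraph K →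
      Disjoint (V G) (V H) → Disjoint (V G) (V K) → Disjoint (V H) (V K) →
      (G · H) · K ≡ G · (H · K))
    -- product commutative
    × ((G H : MGraph n) → IsMixedGraph G → IsMixedGraph H →
      Disjoint (V G) (V H) → G · H ≡ H · G)
    -- unit
    × ((G : MGraph n) → IsMixedGraph G → (one · G ≡ G) × (G · one ≡ G))
    -- coassociativity
    × ((X Y Z : Subset n) → Disjoint X Y → Disjoint X Z → Disjoint Y Z →
      (G : MGraph n) → IsMixedGraph G → V G ≡ (X ∪ Y) ∪ Z →
      Δ⊗Id X Y (Δ (X ∪ Y) Z G) ≡ Id⊗Δ Y Z (Δ X (Y ∪ Z) G))
    -- counit
    × ((G : MGraph n) → IsMixedGraph G →
      (Δ (V G) ⊥ G ≡ just (G , one)) × (Δ ⊥ (V G) G ≡ just (one , G)))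
    -- compatibility of product and coproduct
    × ((X Y X′ Y′ : Subset n) → Disjoint X Y → Disjoint X′ Y′ → X ∪ Y ≡ X′ ∪ Y′ →
      (G H : MGraph n) → IsMixedGraph G → IsMixedGraph H → V G ≡ X → V H ≡ Y →
      Δ X′ Y′ (G · H) ≡ Δ (X ∩ X′) (X ∩ Y′) G ⊙ Δ (Y ∩ X′) (Y ∩ Y′) H)
    × (Δ ⊥ ⊥ (one {n}) ≡ just (one , one))
proposition1p4 n =
    (λ G H K _ _ _ _ _ _ → ·-assoc G H K)
  , (λ G H _ _ _ → ·-comm G H)
  , (λ G _ → ·-identityˡ G , ·-identityʳ G)
  , (λ X Y Z _ X∩Z≡⊥ _ G G-mixed V≡X∪Y∪Z → Δ-coassoc G-mixed V≡X∪Y∪Z X∩Z≡⊥)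
  , (λ G G-mixed → Δ-counitʳ G-mixed , Δ-counitˡ G-mixed)
  , (λ X Y X′ Y′ _ _ _ G H → Δ-compatible)
  , Δ-one
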